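{- Let $G$ be an $n$-vertex circular-arc graph. Then $h(G)\le \frac{3n}{\alpha(G)}-2$. In particular, if $\alpha(G)=cn$ for some $c>0$, then $h(G)\le \frac{3}{c}-2$.
   Context: A circular-arc graph is the intersection graph of a finite family of arcs on a circle (adjacent iff the arcs intersect). $\alpha(G)$ is the independence number. A hitting set of $G$ is a set $T\subseteq V(G)$ meeting every maximum independent set; $h(G)$ is its minimum size. -}

module Defs where

open import Data.Nat using (ℕ; suc; _+_; _∸_; _≤_; _%_)
open import Data.Fin using (Fin; toℕ)
open import Data.Fin.Subset using (Subset; _∈_; ∣_∣)
open import Data.Product using (Σ; _×_; ∃)
open import Relation.Binary.PropositionalEquality using (_≡_)
open import Relation.Nullary using (¬_)

-- The circle is discretised as the cyclic group ℤ/(suc k) of points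
-- 0,1,…,k (in cyclic order).  A (closed) arc is given by a start point
-- and a length ℓ; it consists of the points start, start+1, …, start+ℓ
-- (mod suc k).  Length ≥ k gives the whole circle.
record Arc (k : ℕ) : Set where
  constructor arc
  field
    start  : Fin (suc k)
    length : ℕ

_∈Arc_ : ∀ {k} → Fin (suc k) → Arc k → Set
_∈Arc_ {k} p a = ((toℕ p + suc k ∸ toℕ (Arc.start a)) % suc k) ≤ Arc.length a

ArcModel : ℕ → ℕ → Set
ArcModel k n = Fin n → Arc k

Adj : ∀ {k n} → ArcModel k n → Fin n → Fin n → Set
Adj {k} A u v = ¬ (u ≡ v) × ∃ λ (p : Fin (suc k)) → (p ∈Arc A u) × (p ∈Arc A v)

Independent : ∀ {k n} → ArcModel k n → Subset n → Set
Independent A S = ∀ u v → u ∈ S → v ∈ S → ¬ Adj A u v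

MaximumIndependent : ∀ {k n} → ArcModel k n → Subset n → Set
MaximumIndependent {n = n} A S =
  Independent A S × (∀ (T : Subset n) → Independent A T → ∣ T ∣ ≤ ∣ S ∣)

HittingSet : ∀ {k n} → ArcModel k n → Subset n → Set
HittingSet {n = n} A T =
  ∀ (S : Subset n) → MaximumIndependent A S → ∃ λ (v : Fin n) → (v ∈ T) × (v ∈ S)

-- For a vertex v let T[ v ] be the closed neighbourhood N[v] with every vertex removed whose
-- arc contains the arcs of two distinct members of S.  Each T[ v ] is a hitting set: a maximum
-- independent set S′ dominates v, so it has a vertex u in N[v], and if the arc of u contained
-- the arcs of two members of S, swapping u for them would give a larger independent set.
-- Double counting gives Σ_{v∈S} (|T[ v ]| + 2) ≤ 3n: a vertex u ∈ S lies only in T[ u ], and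
-- an arc of a vertex v ∈ S meeting the arc of u ∉ S contains its start or its end or lies
-- inside it, each for at most one such v.  A vertex v ∈ S at most the average then has
-- (|T[ v ]| + 2) |S| ≤ 3n.
module Submission where

open import Defs
open import Data.Nat.Properties hiding (_≟_; suc-injective)
open import Algebra.Properties.Semiring.Sum +-*-semiring
  using (sum; sum-syntax; sum-cong-≗; sum-replicate-zero; sum-remove;
         ∑-distrib-+; ∑-comm; *-distribˡ-sum; *-distribʳ-sum)
open import Data.Bool.Base using (true; if_then_else_)
open import Data.Fin.Base using (Fin; zero; suc; toℕ; fromℕ<)
open import Data.Fin.Properties using (suc-injective; any?; all?; _≟_; toℕ<n; toℕ-fromℕ<)
open import Data.Fin.Subset using (Subset; ∣_∣; _∈_; inside; outside)
open import Data.Fin.Subset.Properties using (_∈?_)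
open import Data.Nat.Base using (ℕ; zero; suc; _+_; _*_; _∸_; _≤_; _<_; z≤n; s≤s; NonZero; >-nonZero⁻¹)
open import Data.Nat.DivMod using (_%_; %-distribˡ-+; m%n%n≡m%n; m%n<n; [m+n]%n≡m%n; m<n⇒m%n≡m)
open import Data.Product using (Σ; _×_; _,_; proj₁; proj₂; ∃; ∃₂; ∃-syntax)
open import Data.Sum.Base using (_⊎_; inj₁; inj₂)
open import Data.Unit.Base using (tt)
open import Data.Vec.Base using ([]; _∷_; tabulate)
open import Data.Vec.Properties using (lookup∘tabulate; []=⇒lookup; lookup⇒[]=)
open import Function.Base using (_∘_; id)
open import Level using (0ℓ)
open import Relation.Binary.PropositionalEquality
open import Relation.Nullary using (¬_; Dec; yes; no; does; contradiction)
open import Relation.Nullary.Decidable using (_×-dec_; _⊎-dec_; ¬?; _→-dec_)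
open import Relation.Unary using (Pred; Decidable)

𝟙 : {P : Set} → Dec P → ℕ
𝟙 d = if does d then 1 else 0

module _ {P Q : Set} where

  𝟙-mono : (P → Q) → (p : Dec P) (q : Dec Q) → 𝟙 p ≤ 𝟙 q
  𝟙-mono f (yes p) (yes _) = ≤-refl
  𝟙-mono f (yes p) (no ¬q) = contradiction (f p) ¬q
  𝟙-mono f (no _)  _       = z≤n

  𝟙-×-dec : (p : Dec P) (q : Dec Q) → 𝟙 (p ×-dec q) ≡ 𝟙 p * 𝟙 q
  𝟙-×-dec (yes _) (yes _) = refl
  𝟙-×-dec (yes _) (no _)  = refl
  𝟙-×-dec (no _)  _       = refl

  𝟙-⊎-dec : (p : Dec P) (q : Dec Q) → 𝟙 (p ⊎-dec q) ≤ 𝟙 p + 𝟙 q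
  𝟙-⊎-dec (yes _) _       = s≤s z≤n
  𝟙-⊎-dec (no _)  (yes _) = ≤-refl
  𝟙-⊎-dec (no _)  (no _)  = z≤n

  𝟙-⊎-dec-disjoint : ¬ (P × Q) → (p : Dec P) (q : Dec Q) → 𝟙 (p ⊎-dec q) ≡ 𝟙 p + 𝟙 q
  𝟙-⊎-dec-disjoint disj (yes p) (yes q) = contradiction (p , q) disj
  𝟙-⊎-dec-disjoint disj (yes _) (no _)  = refl
  𝟙-⊎-dec-disjoint disj (no _)  (yes _) = refl
  𝟙-⊎-dec-disjoint disj (no _)  (no _)  = refl

∑-mono-≤ : ∀ {n} {f g : Fin n → ℕ} → (∀ i → f i ≤ g i) → ∑[ i < n ] f i ≤ ∑[ i < n ] g i
∑-mono-≤ {zero}  f≤g = z≤n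
∑-mono-≤ {suc n} f≤g = +-mono-≤ (f≤g zero) (∑-mono-≤ (f≤g ∘ suc))

∑-bounded : ∀ {n} {f : Fin n → ℕ} c → (∀ i → f i ≤ c) → ∑[ i < n ] f i ≤ n * c
∑-bounded {zero}  c f≤c = z≤n
∑-bounded {suc n} c f≤c = +-mono-≤ (f≤c zero) (∑-bounded c (f≤c ∘ suc))

∑-term≤ : ∀ {n} (f : Fin n → ℕ) i → f i ≤ ∑[ i < n ] f i
∑-term≤ {suc n} f i = ≤-trans (m≤m+n (f i) _) (≤-reflexive (sym (sum-remove {i = i} f)))

∃-below-average : ∀ {n} (w g : Fin (suc n) → ℕ) {B} →
  ∑[ i < suc n ] (w i * g i) ≤ B → ∃[ i ] g i * sum w ≤ B
∃-below-average {n} w g {B} ∑wg≤B with any? (λ i → g i * sum w ≤? B)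
... | yes small = small
... | no ¬small = contradiction (subst (B <_) g₀*W≡0 (all-large zero)) n≮0
  where
  W = sum w
  all-large : ∀ i → B < g i * W
  all-large i = ≰⇒> (λ le → ¬small (i , le))
  W*1+B≤W*B : W * suc B ≤ W * B
  W*1+B≤W*B = begin
    W * suc B                      ≡⟨ *-distribʳ-sum (suc B) w ⟩
    ∑[ i < suc n ] (w i * suc B)   ≤⟨ ∑-mono-≤ (λ i → *-monoʳ-≤ (w i) (all-large i)) ⟩
    ∑[ i < suc n ] (w i * (g i * W)) ≡⟨ sum-cong-≗ (λ i → *-assoc (w i) (g i) W) ⟨
    ∑[ i < suc n ] (w i * g i * W) ≡⟨ *-distribʳ-sum W (λ i → w i * g i) ⟨
    ∑[ i < suc n ] (w i * g i) * W ≤⟨ *-monoˡ-≤ W ∑wg≤B ⟩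
    B * W                          ≡⟨ *-comm B W ⟩
    W * B                          ∎
    where open ≤-Reasoning
  W≡0 : W ≡ 0
  W≡0 = n≤0⇒n≡0 (subst (W ≤_) (n∸n≡0 (W * B))
          (m+n≤o⇒m≤o∸n W (subst (_≤ W * B) (*-suc W B) W*1+B≤W*B)))
  g₀*W≡0 : g zero * W ≡ 0
  g₀*W≡0 = trans (cong (g zero *_) W≡0) (*-zeroʳ (g zero))

module _ {n : ℕ} where

  # : {P : Pred (Fin n) 0ℓ} → Decidable P → ℕ
  # P? = ∑[ i < n ] 𝟙 (P? i)

  module _ {P Q : Pred (Fin n) 0ℓ} (P? : Decidable P) (Q? : Decidable Q) where

    #-mono : (∀ {i} → P i → Q i) → # P? ≤ # Q?
    #-mono P⊆Q = ∑-mono-≤ (λ i → 𝟙-mono P⊆Q (P? i) (Q? i))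

    #-⊎-disjoint : (∀ {i} → ¬ (P i × Q i)) → # (λ i → P? i ⊎-dec Q? i) ≡ # P? + # Q?
    #-⊎-disjoint disj = trans (sum-cong-≗ (λ i → 𝟙-⊎-dec-disjoint disj (P? i) (Q? i)))
                              (∑-distrib-+ (𝟙 ∘ P?) (𝟙 ∘ Q?))

  #-⊎ : {P Q R : Pred (Fin n) 0ℓ} (P? : Decidable P) (Q? : Decidable Q) (R? : Decidable R) →
        (∀ {i} → P i → Q i ⊎ R i) → # P? ≤ # Q? + # R?
  #-⊎ P? Q? R? P⊆Q∪R = begin
    # P?                              ≤⟨ #-mono P? (λ i → Q? i ⊎-dec R? i) P⊆Q∪R ⟩
    ∑[ i < n ] 𝟙 (Q? i ⊎-dec R? i)    ≤⟨ ∑-mono-≤ (λ i → 𝟙-⊎-dec (Q? i) (R? i)) ⟩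
    ∑[ i < n ] (𝟙 (Q? i) + 𝟙 (R? i)) ≡⟨ ∑-distrib-+ (𝟙 ∘ Q?) (𝟙 ∘ R?) ⟩
    # Q? + # R?                      ∎
    where open ≤-Reasoning

  #≥1 : {P : Pred (Fin n) 0ℓ} (P? : Decidable P) → ∀ {i} → P i → 1 ≤ # P?
  #≥1 P? {i} Pi = ≤-trans (𝟙-mono (λ _ → Pi) (yes tt) (P? i)) (∑-term≤ (𝟙 ∘ P?) i)

#≤1 : ∀ {n} {P : Pred (Fin n) 0ℓ} (P? : Decidable P) → (∀ {i j} → P i → P j → i ≡ j) → # P? ≤ 1
#≤1 {zero}  P? unique = z≤n
#≤1 {suc n} P? unique with P? zero
... | yes P0 = s≤s (≤-reflexive (trans (sum-cong-≗ (λ i → none i)) (sum-replicate-zero n)))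
  where
  none : ∀ i → 𝟙 (P? (suc i)) ≡ 0
  none i with P? (suc i)
  ... | yes Pi = contradiction (unique P0 Pi) λ ()
  ... | no _   = refl
... | no _ = #≤1 (P? ∘ suc) (λ Pi Pj → suc-injective (unique Pi Pj))

module _ {n} {P : Pred (Fin n) 0ℓ} (P? : Decidable P) where

  #<#-insert : ∀ {v} → ¬ P v → # P? < # (λ i → P? i ⊎-dec i ≟ v)
  #<#-insert {v} ¬Pv = begin-strict
    # P?                 <⟨ m<m+n (# P?) (#≥1 (_≟ v) refl) ⟩
    # P? + # (_≟ v)      ≡⟨ #-⊎-disjoint P? (_≟ v) (λ { (Pi , refl) → ¬Pv Pi }) ⟨
    # (λ i → P? i ⊎-dec i ≟ v) ∎
    where open ≤-Reasoning

  #<#-replace-one-by-two : ∀ {u v w} → v ≢ w →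
    (∀ {i} → ¬ ((P i × i ≢ u) × (i ≡ v ⊎ i ≡ w))) →
    # P? < # (λ i → (P? i ×-dec ¬? (i ≟ u)) ⊎-dec (i ≟ v ⊎-dec i ≟ w))
  #<#-replace-one-by-two {u} {v} {w} v≢w disjoint = begin-strict
    # P?                           ≤⟨ #-mono P? (λ i → Kept? i ⊎-dec i ≟ u) kept-or-u ⟩
    # (λ i → Kept? i ⊎-dec i ≟ u)  ≡⟨ #-⊎-disjoint Kept? (_≟ u) (λ ((_ , i≢u) , i≡u) → i≢u i≡u) ⟩
    # Kept? + # (_≟ u)             ≤⟨ +-monoʳ-≤ (# Kept?) #u≤1 ⟩
    # Kept? + 1                    <⟨ +-monoʳ-< (# Kept?) ≤-refl ⟩
    # Kept? + 2                    ≤⟨ +-monoʳ-≤ (# Kept?) 2≤#New ⟩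
    # Kept? + # New?               ≡⟨ #-⊎-disjoint Kept? New? disjoint ⟨
    # (λ i → Kept? i ⊎-dec New? i) ∎
    where
    open ≤-Reasoning
    Kept? = λ i → P? i ×-dec ¬? (i ≟ u)
    New? = λ i → i ≟ v ⊎-dec i ≟ w
    kept-or-u : ∀ {i} → P i → (P i × i ≢ u) ⊎ i ≡ u
    kept-or-u {i} Pi with i ≟ u
    ... | yes i≡u = inj₂ i≡u
    ... | no  i≢u = inj₁ (Pi , i≢u)
    #u≤1 : # (_≟ u) ≤ 1
    #u≤1 = #≤1 (_≟ u) (λ i≡u j≡u → trans i≡u (sym j≡u))
    2≤#New : 2 ≤ # New?
    2≤#New = begin
      2                   ≤⟨ +-mono-≤ (#≥1 (_≟ v) refl) (#≥1 (_≟ w) refl) ⟩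
      # (_≟ v) + # (_≟ w) ≡⟨ #-⊎-disjoint (_≟ v) (_≟ w) (λ { (refl , refl) → v≢w refl }) ⟨
      # New?              ∎

toSubset : ∀ {n} {P : Pred (Fin n) 0ℓ} → Decidable P → Subset n
toSubset P? = tabulate (does ∘ P?)

module _ {n} {P : Pred (Fin n) 0ℓ} (P? : Decidable P) where

  ∈-toSubset⁺ : ∀ {i} → P i → i ∈ toSubset P?
  ∈-toSubset⁺ {i} Pi = lookup⇒[]= i _ (trans (lookup∘tabulate (does ∘ P?) i) (does-yes (P? i)))
    where
    does-yes : (d : Dec (P i)) → does d ≡ true
    does-yes (yes _) = refl
    does-yes (no ¬Pi) = contradiction Pi ¬Pi

  ∈-toSubset⁻ : ∀ {i} → i ∈ toSubset P? → P i
  ∈-toSubset⁻ {i} i∈ with P? i | trans (sym (lookup∘tabulate (does ∘ P?) i)) ([]=⇒lookup i∈)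
  ... | yes Pi | _ = Pi

∣toSubset∣≡# : ∀ {n} {P : Pred (Fin n) 0ℓ} (P? : Decidable P) → ∣ toSubset P? ∣ ≡ # P?
∣toSubset∣≡# {zero}  P? = refl
∣toSubset∣≡# {suc n} P? with P? zero
... | yes _ = cong suc (∣toSubset∣≡# (P? ∘ suc))
... | no _  = ∣toSubset∣≡# (P? ∘ suc)

∣p∣≡#∈ : ∀ {n} (p : Subset n) → ∣ p ∣ ≡ # (_∈? p)
∣p∣≡#∈ []            = refl
∣p∣≡#∈ (inside  ∷ p) = cong suc (∣p∣≡#∈ p)
∣p∣≡#∈ (outside ∷ p) = ∣p∣≡#∈ p

double-counting : ∀ {m n} {P : Pred (Fin m) 0ℓ} {R : Fin m → Pred (Fin n) 0ℓ}
  (P? : Decidable P) (R? : ∀ i → Decidable (R i)) →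
  ∑[ i < m ] (𝟙 (P? i) * # (R? i)) ≡ ∑[ j < n ] # (λ i → P? i ×-dec R? i j)
double-counting {m} {n} P? R? = begin
  ∑[ i < m ] (𝟙 (P? i) * # (R? i))
    ≡⟨ sum-cong-≗ (λ i → *-distribˡ-sum (𝟙 (P? i)) (𝟙 ∘ R? i)) ⟩
  ∑[ i < m ] ∑[ j < n ] (𝟙 (P? i) * 𝟙 (R? i j))
    ≡⟨ sum-cong-≗ (λ i → sum-cong-≗ (λ j → 𝟙-×-dec (P? i) (R? i j))) ⟨
  ∑[ i < m ] ∑[ j < n ] 𝟙 (P? i ×-dec R? i j)
    ≡⟨ ∑-comm (λ i j → 𝟙 (P? i ×-dec R? i j)) ⟩
  ∑[ j < n ] ∑[ i < m ] 𝟙 (P? i ×-dec R? i j)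
    ∎
  where open ≡-Reasoning

[m%o+n]%o≡[m+n]%o : ∀ m n o .{{_ : NonZero o}} → (m % o + n) % o ≡ (m + n) % o
[m%o+n]%o≡[m+n]%o m n o = begin
  (m % o + n) % o         ≡⟨ %-distribˡ-+ (m % o) n o ⟩
  (m % o % o + n % o) % o ≡⟨ cong (λ x → (x + n % o) % o) (m%n%n≡m%n m o) ⟩
  (m % o + n % o) % o     ≡⟨ %-distribˡ-+ m n o ⟨
  (m + n) % o             ∎
  where open ≡-Reasoning

[m+n%o]%o≡[m+n]%o : ∀ m n o .{{_ : NonZero o}} → (m + n % o) % o ≡ (m + n) % o
[m+n%o]%o≡[m+n]%o m n o = begin
  (m + n % o) % o ≡⟨ cong (_% o) (+-comm m (n % o)) ⟩
  (n % o + m) % o ≡⟨ [m%o+n]%o≡[m+n]%o n m o ⟩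
  (n + m) % o     ≡⟨ cong (_% o) (+-comm n m) ⟩
  (m + n) % o     ∎
  where open ≡-Reasoning

-- offset s p is the clockwise distance from s to p on a circle of K points, so that
-- p ∈Arc a unfolds to offset (start a) p ≤ length a.
module Offset (K : ℕ) .{{_ : NonZero K}} where

  offset : ℕ → ℕ → ℕ
  offset s p = (p + K ∸ s) % K

  offset<K : ∀ s p → offset s p < K
  offset<K s p = m%n<n (p + K ∸ s) K

  offset-+ : ∀ {s} p → s ≤ K → (offset s p + s) % K ≡ p % K
  offset-+ {s} p s≤K = begin
    ((p + K ∸ s) % K + s) % K ≡⟨ [m%o+n]%o≡[m+n]%o (p + K ∸ s) s K ⟩
    (p + K ∸ s + s) % K       ≡⟨ cong (_% K) (m∸n+n≡m (≤-trans s≤K (m≤n+m K p))) ⟩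
    (p + K) % K               ≡⟨ [m+n]%n≡m%n p K ⟩
    p % K                     ∎
    where open ≡-Reasoning

  offset-cong : ∀ {s p q} → s ≤ K → p % K ≡ q % K → offset s p ≡ offset s q
  offset-cong {s} {p} {q} s≤K p≡q = begin
    (p + K ∸ s) % K       ≡⟨ cong (_% K) (+-∸-assoc p s≤K) ⟩
    (p + (K ∸ s)) % K     ≡⟨ [m%o+n]%o≡[m+n]%o p (K ∸ s) K ⟨
    (p % K + (K ∸ s)) % K ≡⟨ cong (λ x → (x + (K ∸ s)) % K) p≡q ⟩
    (q % K + (K ∸ s)) % K ≡⟨ [m%o+n]%o≡[m+n]%o q (K ∸ s) K ⟩
    (q + (K ∸ s)) % K     ≡⟨ cong (_% K) (+-∸-assoc q s≤K) ⟨
    (q + K ∸ s) % K       ∎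
    where open ≡-Reasoning

  offset-+ʳ : ∀ s {r} → r < K → offset s (r + s) ≡ r
  offset-+ʳ s {r} r<K = begin
    (r + s + K ∸ s) % K ≡⟨ cong (λ x → (x ∸ s) % K) (+-comm (r + s) K) ⟩
    (K + (r + s) ∸ s) % K ≡⟨ cong (λ x → (x ∸ s) % K) (+-assoc K r s) ⟨
    (K + r + s ∸ s) % K ≡⟨ cong (_% K) (m+n∸n≡m (K + r) s) ⟩
    (K + r) % K         ≡⟨ cong (_% K) (+-comm K r) ⟩
    (r + K) % K         ≡⟨ [m+n]%n≡m%n r K ⟩
    r % K               ≡⟨ m<n⇒m%n≡m r<K ⟩
    r                   ∎
    where open ≡-Reasoning

  offset-unique : ∀ {s p r} → s ≤ K → r < K → (r + s) % K ≡ p % K → offset s p ≡ r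
  offset-unique {s} s≤K r<K r+s≡p = trans (offset-cong s≤K (sym r+s≡p)) (offset-+ʳ s r<K)

  offset-self : ∀ s → offset s s ≡ 0
  offset-self s = offset-+ʳ s (>-nonZero⁻¹ K)

  offset-rotate : ∀ {t b} p → t ≤ K → b ≤ K → offset (offset t b) (offset t p) ≡ offset b p
  offset-rotate {t} {b} p t≤K b≤K = sym (offset-unique b≤K (offset<K B P) R+b≡p)
    where
    open ≡-Reasoning
    P = offset t p
    B = offset t b
    R = offset B P
    R+b≡p : (R + b) % K ≡ p % K
    R+b≡p = begin
      (R + b) % K           ≡⟨ [m+n%o]%o≡[m+n]%o R b K ⟨
      (R + b % K) % K       ≡⟨ cong (λ x → (R + x) % K) (offset-+ b t≤K) ⟨
      (R + (B + t) % K) % K ≡⟨ [m+n%o]%o≡[m+n]%o R (B + t) K ⟩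
      (R + (B + t)) % K     ≡⟨ cong (_% K) (+-assoc R B t) ⟨
      (R + B + t) % K       ≡⟨ [m%o+n]%o≡[m+n]%o (R + B) t K ⟨
      ((R + B) % K + t) % K ≡⟨ cong (λ x → (x + t) % K) (offset-+ P (<⇒≤ (offset<K t b))) ⟩
      (P % K + t) % K       ≡⟨ [m%o+n]%o≡[m+n]%o P t K ⟩
      (P + t) % K           ≡⟨ offset-+ p t≤K ⟩
      p % K                 ∎

  offset-≤ : ∀ {s p} → s ≤ p → p < K → offset s p ≡ p ∸ s
  offset-≤ {s} {p} s≤p p<K =
    offset-unique (≤-trans s≤p (<⇒≤ p<K)) (≤-<-trans (m∸n≤m p s) p<K) (cong (_% K) (m∸n+n≡m s≤p))

  offset-> : ∀ {s p} → p < s → s ≤ K → offset s p ≡ p + K ∸ s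
  offset-> {s} {p} p<s s≤K = m<n⇒m%n≡m (m<n+o⇒m∸n<o (p + K) s (+-monoˡ-< K p<s))

  offset-0≤ : ∀ {β z} → β ≤ K → z < β → offset β 0 ≤ offset β z
  offset-0≤ {β} {z} β≤K z<β = begin
    offset β 0 ≡⟨ offset-> (≤-<-trans z≤n z<β) β≤K ⟩
    K ∸ β      ≤⟨ ∸-monoˡ-≤ β (m≤n+m K z) ⟩
    z + K ∸ β  ≡⟨ offset-> z<β β≤K ⟨
    offset β z ∎
    where open ≤-Reasoning

  0∉[β,β+ℓ]⇒β≤ : ∀ {β ℓ z} → β ≤ K → ¬ offset β 0 ≤ ℓ → offset β z ≤ ℓ → β ≤ z
  0∉[β,β+ℓ]⇒β≤ {β} {ℓ} {z} β≤K 0∉ z∈ with β ≤? z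
  ... | yes β≤z = β≤z
  ... | no  β≰z = contradiction (≤-trans (offset-0≤ β≤K (≰⇒> β≰z)) z∈) 0∉

  [β,β+ℓ]⊆[0,e] : ∀ {β ℓ e x y} → β ≤ K → e < K → y < K →
    ¬ offset β 0 ≤ ℓ → ¬ offset β e ≤ ℓ →
    offset β x ≤ ℓ → x ≤ e → offset β y ≤ ℓ → y ≤ e
  [β,β+ℓ]⊆[0,e] {β} {ℓ} {e} {x} {y} β≤K e<K y<K 0∉ e∉ x∈ x≤e y∈ with y ≤? e
  ... | yes y≤e = y≤e
  ... | no  y≰e = contradiction e∈ e∉
    where
    open ≤-Reasoning
    β≤e = ≤-trans (0∉[β,β+ℓ]⇒β≤ β≤K 0∉ x∈) x≤e
    β≤y = 0∉[β,β+ℓ]⇒β≤ β≤K 0∉ y∈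
    e∈ : offset β e ≤ ℓ
    e∈ = begin
      offset β e ≡⟨ offset-≤ β≤e e<K ⟩
      e ∸ β      ≤⟨ ∸-monoˡ-≤ β (<⇒≤ (≰⇒> y≰e)) ⟩
      y ∸ β      ≡⟨ offset-≤ β≤y y<K ⟨
      offset β y ≤⟨ y∈ ⟩
      ℓ          ∎

module _ {k : ℕ} where
  open Offset (suc k)

  _⊆ᵃ_ : Arc k → Arc k → Set
  a ⊆ᵃ b = ∀ p → p ∈Arc a → p ∈Arc b

  Meets : Arc k → Arc k → Set
  Meets a b = ∃ λ p → p ∈Arc a × p ∈Arc b

  end : Arc k → Fin (suc k)
  end (arc s ℓ) = fromℕ< (m%n<n (toℕ s + ℓ) (suc k))

  _∈Arc?_ : (p : Fin (suc k)) (a : Arc k) → Dec (p ∈Arc a)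
  p ∈Arc? arc s ℓ = offset (toℕ s) (toℕ p) ≤? ℓ

  _⊆ᵃ?_ : (a b : Arc k) → Dec (a ⊆ᵃ b)
  a ⊆ᵃ? b = all? (λ p → p ∈Arc? a →-dec p ∈Arc? b)

  Meets? : (a b : Arc k) → Dec (Meets a b)
  Meets? a b = any? (λ p → p ∈Arc? a ×-dec p ∈Arc? b)

  start∈Arc : (a : Arc k) → Arc.start a ∈Arc a
  start∈Arc a = ≤-trans (≤-reflexive (offset-self (toℕ (Arc.start a)))) z≤n

  Meets-sym : ∀ {a b} → Meets a b → Meets b a
  Meets-sym (p , p∈a , p∈b) = p , p∈b , p∈a

  Meets-⊆ᵃ : ∀ {a b c} → Meets a b → b ⊆ᵃ c → Meets a c
  Meets-⊆ᵃ (p , p∈a , p∈b) b⊆c = p , p∈a , b⊆c p p∈b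

  offset-end : ∀ s {ℓ} → ℓ < suc k → offset (toℕ s) (toℕ (end (arc s ℓ))) ≡ ℓ
  offset-end s {ℓ} ℓ<K = begin
    offset (toℕ s) (toℕ (end (arc s ℓ)))  ≡⟨ cong (offset (toℕ s)) (toℕ-fromℕ< _) ⟩
    offset (toℕ s) ((toℕ s + ℓ) % suc k)  ≡⟨ offset-cong (<⇒≤ (toℕ<n s)) s+ℓ≡ℓ+s ⟩
    offset (toℕ s) (ℓ + toℕ s)            ≡⟨ offset-+ʳ (toℕ s) ℓ<K ⟩
    ℓ                                     ∎
    where
    open ≡-Reasoning
    s+ℓ≡ℓ+s : (toℕ s + ℓ) % suc k % suc k ≡ (ℓ + toℕ s) % suc k
    s+ℓ≡ℓ+s = trans (m%n%n≡m%n (toℕ s + ℓ) (suc k)) (cong (_% suc k) (+-comm (toℕ s) ℓ))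

  -- Rotating by the start s of a turns a into [0, e] and b into [β, β + ℓ] with β = offset s t.
  -- When e ≥ K the arc a is the whole circle.
  no-endpoint⇒⊆ᵃ : (a b : Arc k) → Meets a b → ¬ Arc.start a ∈Arc b → ¬ end a ∈Arc b → b ⊆ᵃ a
  no-endpoint⇒⊆ᵃ (arc s e) (arc t ℓ) (x , x∈a , x∈b) s∉b e∉b y y∈b with e <? suc k
  ... | no  e≮K = <⇒≤ (<-≤-trans (offset<K (toℕ s) (toℕ y)) (≮⇒≥ e≮K))
  ... | yes e<K = [β,β+ℓ]⊆[0,e] (<⇒≤ (offset<K s′ t′)) e<K (offset<K s′ (toℕ y))
                    0∉ e∉ (in-frame x∈b) x∈a (in-frame y∈b)
    where
    s′ = toℕ s
    t′ = toℕ t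
    β = offset s′ t′
    rotate : ∀ q → offset β (offset s′ q) ≡ offset t′ q
    rotate q = offset-rotate q (<⇒≤ (toℕ<n s)) (<⇒≤ (toℕ<n t))
    in-frame : ∀ {q} → q ∈Arc arc t ℓ → offset β (offset s′ (toℕ q)) ≤ ℓ
    in-frame {q} = subst (_≤ ℓ) (sym (rotate (toℕ q)))
    0∉ : ¬ offset β 0 ≤ ℓ
    0∉ = s∉b ∘ subst (_≤ ℓ) (trans (cong (offset β) (sym (offset-self s′))) (rotate s′))
    e∉ : ¬ offset β e ≤ ℓ
    e∉ = e∉b ∘ subst (_≤ ℓ) (trans (cong (offset β) (sym (offset-end s e<K))) (rotate _))

  meets⇒endpoint⊎⊆ᵃ : (a b : Arc k) → Meets a b → Arc.start a ∈Arc b ⊎ end a ∈Arc b ⊎ b ⊆ᵃ a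
  meets⇒endpoint⊎⊆ᵃ a b meets with Arc.start a ∈Arc? b | end a ∈Arc? b
  ... | yes s∈b | _       = inj₁ s∈b
  ... | no  _   | yes e∈b = inj₂ (inj₁ e∈b)
  ... | no  s∉b | no  e∉b = inj₂ (inj₂ (no-endpoint⇒⊆ᵃ a b meets s∉b e∉b))

module IntersectionGraph {k n : ℕ} (A : ArcModel k n) where

  _∈N[_] : Fin n → Fin n → Set
  u ∈N[ v ] = u ≡ v ⊎ Adj A v u

  Adj? : ∀ u v → Dec (Adj A u v)
  Adj? u v = ¬? (u ≟ v) ×-dec Meets? (A u) (A v)

  _∈N[_]? : ∀ u v → Dec (u ∈N[ v ])
  u ∈N[ v ]? = u ≟ v ⊎-dec Adj? v u

  Adj-sym : ∀ {u v} → Adj A u v → Adj A v u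
  Adj-sym {u} {v} (u≢v , meets) = u≢v ∘ sym , Meets-sym {a = A u} {b = A v} meets

  ⊆ᵃ⇒Adj : ∀ {u v} → u ≢ v → A u ⊆ᵃ A v → Adj A u v
  ⊆ᵃ⇒Adj {u} u≢v u⊆v = u≢v , Arc.start (A u) , start∈Arc (A u) , u⊆v _ (start∈Arc (A u))

  Adj-⊆ᵃ : ∀ {u v w} → u ≢ w → Adj A u v → A v ⊆ᵃ A w → Adj A u w
  Adj-⊆ᵃ {u} {v} {w} u≢w (_ , meets) v⊆w = u≢w , Meets-⊆ᵃ {a = A u} {b = A v} {c = A w} meets v⊆w

  maximum⇒dominating : ∀ {S} → MaximumIndependent A S → ∀ v → ∃[ u ] u ∈ S × u ∈N[ v ]
  maximum⇒dominating {S} (S-ind , S-max) v with any? (λ u → u ∈? S ×-dec u ∈N[ v ]?)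
  ... | yes dominated = dominated
  ... | no  undominated = contradiction (S-max X X-ind) (<⇒≱ ∣S∣<∣X∣)
    where
    X? = λ i → i ∈? S ⊎-dec i ≟ v
    X = toSubset X?
    X-ind : Independent A X
    X-ind i j i∈X j∈X with ∈-toSubset⁻ X? i∈X | ∈-toSubset⁻ X? j∈X
    ... | inj₁ i∈S  | inj₁ j∈S  = S-ind i j i∈S j∈S
    ... | inj₁ i∈S  | inj₂ refl = λ adj → undominated (i , i∈S , inj₂ (Adj-sym adj))
    ... | inj₂ refl | inj₁ j∈S  = λ adj → undominated (j , j∈S , inj₂ adj)
    ... | inj₂ refl | inj₂ refl = λ adj → proj₁ adj refl
    ∣S∣<∣X∣ : ∣ S ∣ < ∣ X ∣
    ∣S∣<∣X∣ = begin-strict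
      ∣ S ∣      ≡⟨ ∣p∣≡#∈ S ⟩
      # (_∈? S)  <⟨ #<#-insert (_∈? S) (λ v∈S → undominated (v , v∈S , inj₁ refl)) ⟩
      # X?       ≡⟨ ∣toSubset∣≡# X? ⟨
      ∣ X ∣      ∎
      where open ≤-Reasoning

  module Trimmed {S : Subset n} (S-ind : Independent A S) where

    ContainsTwo : Fin n → Set
    ContainsTwo u = ∃₂ λ v w → v ∈ S × w ∈ S × v ≢ w × A v ⊆ᵃ A u × A w ⊆ᵃ A u

    ContainsTwo? : ∀ u → Dec (ContainsTwo u)
    ContainsTwo? u = any? λ v → any? λ w →
      v ∈? S ×-dec w ∈? S ×-dec ¬? (v ≟ w) ×-dec A v ⊆ᵃ? A u ×-dec A w ⊆ᵃ? A u

    maximum⇒¬ContainsTwo : ∀ {S′ u} → MaximumIndependent A S′ → u ∈ S′ → ¬ ContainsTwo u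
    maximum⇒¬ContainsTwo {S′} {u} (S′-ind , S′-max) u∈S′ (v , w , v∈S , w∈S , v≢w , v⊆u , w⊆u) =
      contradiction (S′-max X X-ind) (<⇒≱ ∣S′∣<∣X∣)
      where
      X? = λ i → (i ∈? S′ ×-dec ¬? (i ≟ u)) ⊎-dec (i ≟ v ⊎-dec i ≟ w)
      X = toSubset X?
      new∈S : ∀ {i} → i ≡ v ⊎ i ≡ w → i ∈ S
      new∈S (inj₁ refl) = v∈S
      new∈S (inj₂ refl) = w∈S
      new⊆u : ∀ {i} → i ≡ v ⊎ i ≡ w → A i ⊆ᵃ A u
      new⊆u (inj₁ refl) = v⊆u
      new⊆u (inj₂ refl) = w⊆u
      kept-new : ∀ {i j} → i ∈ S′ × i ≢ u → j ≡ v ⊎ j ≡ w → ¬ Adj A i j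
      kept-new (i∈S′ , i≢u) j-new adj = S′-ind _ u i∈S′ u∈S′ (Adj-⊆ᵃ i≢u adj (new⊆u j-new))
      X-ind : Independent A X
      X-ind i j i∈X j∈X with ∈-toSubset⁻ X? i∈X | ∈-toSubset⁻ X? j∈X
      ... | inj₁ (i∈S′ , _) | inj₁ (j∈S′ , _) = S′-ind i j i∈S′ j∈S′
      ... | inj₁ i-kept     | inj₂ j-new      = kept-new i-kept j-new
      ... | inj₂ i-new      | inj₁ j-kept     = kept-new j-kept i-new ∘ Adj-sym
      ... | inj₂ i-new      | inj₂ j-new      = S-ind i j (new∈S i-new) (new∈S j-new)
      kept∩new≡∅ : ∀ {i} → ¬ ((i ∈ S′ × i ≢ u) × (i ≡ v ⊎ i ≡ w))
      kept∩new≡∅ ((i∈S′ , i≢u) , i-new) = S′-ind _ u i∈S′ u∈S′ (⊆ᵃ⇒Adj i≢u (new⊆u i-new))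
      ∣S′∣<∣X∣ : ∣ S′ ∣ < ∣ X ∣
      ∣S′∣<∣X∣ = begin-strict
        ∣ S′ ∣     ≡⟨ ∣p∣≡#∈ S′ ⟩
        # (_∈? S′) <⟨ #<#-replace-one-by-two (_∈? S′) v≢w kept∩new≡∅ ⟩
        # X?       ≡⟨ ∣toSubset∣≡# X? ⟨
        ∣ X ∣      ∎
        where open ≤-Reasoning

    _∈T[_] : Fin n → Fin n → Set
    u ∈T[ v ] = u ∈N[ v ] × ¬ ContainsTwo u

    _∈T[_]? : ∀ u v → Dec (u ∈T[ v ])
    u ∈T[ v ]? = u ∈N[ v ]? ×-dec ¬? (ContainsTwo? u)

    T[_] : Fin n → Subset n
    T[ v ] = toSubset (_∈T[ v ]?)

    T-hitting : ∀ v → HittingSet A T[ v ]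
    T-hitting v S′ S′-max =
      let u , u∈S′ , u∈N[v] = maximum⇒dominating S′-max v
      in  u , ∈-toSubset⁺ (_∈T[ v ]?) (u∈N[v] , maximum⇒¬ContainsTwo S′-max u∈S′) , u∈S′

    S-∈Arc-unique : ∀ {p v w} → v ∈ S × p ∈Arc A v → w ∈ S × p ∈Arc A w → v ≡ w
    S-∈Arc-unique {p} {v} {w} (v∈S , p∈v) (w∈S , p∈w) with v ≟ w
    ... | yes v≡w = v≡w
    ... | no  v≢w = contradiction (v≢w , p , p∈v , p∈w) (S-ind v w v∈S w∈S)

    T-degree : Fin n → ℕ
    T-degree u = # (λ v → v ∈? S ×-dec u ∈T[ v ]?)

    T-degree-∈ : ∀ {u} → u ∈ S → T-degree u ≤ 1
    T-degree-∈ {u} u∈S = #≤1 (λ v → v ∈? S ×-dec u ∈T[ v ]?)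
      λ (v∈S , u∈Tv) (w∈S , u∈Tw) → trans (≡u v∈S u∈Tv) (sym (≡u w∈S u∈Tw))
      where
      ≡u : ∀ {v} → v ∈ S → u ∈T[ v ] → v ≡ u
      ≡u v∈S (inj₁ u≡v , _) = sym u≡v
      ≡u v∈S (inj₂ adj , _) = contradiction adj (S-ind _ u v∈S u∈S)

    T-degree-∉ : ∀ {u} → ¬ u ∈ S → T-degree u ≤ 3
    T-degree-∉ {u} u∉S = begin
      T-degree u
        ≤⟨ #-⊎ (λ v → v ∈? S ×-dec u ∈T[ v ]?) Start? EndOrInside? classify ⟩
      # Start? + # EndOrInside?
        ≤⟨ +-monoʳ-≤ (# Start?) (#-⊎ EndOrInside? End? Inside? id) ⟩
      # Start? + (# End? + # Inside?)
        ≤⟨ +-mono-≤ (#≤1 Start? S-∈Arc-unique)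
             (+-mono-≤ (#≤1 End? S-∈Arc-unique) (#≤1 Inside? Inside-unique)) ⟩
      3 ∎
      where
      open ≤-Reasoning
      Inside : Fin n → Set
      Inside v = v ∈ S × A v ⊆ᵃ A u × ¬ ContainsTwo u
      Start? = λ v → v ∈? S ×-dec Arc.start (A u) ∈Arc? A v
      End? = λ v → v ∈? S ×-dec end (A u) ∈Arc? A v
      Inside? = λ v → v ∈? S ×-dec A v ⊆ᵃ? A u ×-dec ¬? (ContainsTwo? u)
      EndOrInside? = λ v → End? v ⊎-dec Inside? v
      classify : ∀ {v} → v ∈ S × u ∈T[ v ] →
        (v ∈ S × Arc.start (A u) ∈Arc A v) ⊎ (v ∈ S × end (A u) ∈Arc A v) ⊎ Inside v
      classify (v∈S , inj₁ refl , _) = contradiction v∈S u∉S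
      classify {v} (v∈S , inj₂ adj , ¬two) with meets⇒endpoint⊎⊆ᵃ (A u) (A v) (proj₂ (Adj-sym adj))
      ... | inj₁ s∈v        = inj₁ (v∈S , s∈v)
      ... | inj₂ (inj₁ e∈v) = inj₂ (inj₁ (v∈S , e∈v))
      ... | inj₂ (inj₂ v⊆u) = inj₂ (inj₂ (v∈S , v⊆u , ¬two))
      Inside-unique : ∀ {v w} → Inside v → Inside w → v ≡ w
      Inside-unique {v} {w} (v∈S , v⊆u , ¬two) (w∈S , w⊆u , _) with v ≟ w
      ... | yes v≡w = v≡w
      ... | no  v≢w = contradiction (v , w , v∈S , w∈S , v≢w , v⊆u , w⊆u) ¬two

    ∑-∣T∣+2 : ∑[ v < n ] (𝟙 (v ∈? S) * (∣ T[ v ] ∣ + 2)) ≤ 3 * n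
    ∑-∣T∣+2 = begin
      ∑[ v < n ] (𝟙 (v ∈? S) * (∣ T[ v ] ∣ + 2))
        ≡⟨ sum-cong-≗ (λ v → *-distribˡ-+ (𝟙 (v ∈? S)) ∣ T[ v ] ∣ 2) ⟩
      ∑[ v < n ] (𝟙 (v ∈? S) * ∣ T[ v ] ∣ + 𝟙 (v ∈? S) * 2)
        ≡⟨ ∑-distrib-+ (λ v → 𝟙 (v ∈? S) * ∣ T[ v ] ∣) (λ v → 𝟙 (v ∈? S) * 2) ⟩
      ∑[ v < n ] (𝟙 (v ∈? S) * ∣ T[ v ] ∣) + ∑[ v < n ] (𝟙 (v ∈? S) * 2)
        ≡⟨ cong (_+ ∑[ v < n ] (𝟙 (v ∈? S) * 2)) ∑∣T∣≡∑T-degree ⟩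
      ∑[ u < n ] T-degree u + ∑[ u < n ] (𝟙 (u ∈? S) * 2)
        ≡⟨ ∑-distrib-+ T-degree (λ u → 𝟙 (u ∈? S) * 2) ⟨
      ∑[ u < n ] (T-degree u + 𝟙 (u ∈? S) * 2)
        ≤⟨ ∑-bounded 3 load≤3 ⟩
      n * 3
        ≡⟨ *-comm n 3 ⟩
      3 * n ∎
      where
      open ≤-Reasoning
      ∑∣T∣≡∑T-degree : ∑[ v < n ] (𝟙 (v ∈? S) * ∣ T[ v ] ∣) ≡ ∑[ u < n ] T-degree u
      ∑∣T∣≡∑T-degree =
        trans (sum-cong-≗ (λ v → cong (𝟙 (v ∈? S) *_) (∣toSubset∣≡# (_∈T[ v ]?))))
              (double-counting (_∈? S) (λ v u → u ∈T[ v ]?))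
      load≤3 : ∀ u → T-degree u + 𝟙 (u ∈? S) * 2 ≤ 3
      load≤3 u with u ∈? S
      ... | yes u∈S = +-monoˡ-≤ 2 (T-degree-∈ u∈S)
      ... | no  u∉S = subst (_≤ 3) (sym (+-identityʳ (T-degree u))) (T-degree-∉ u∉S)

proposition5p2 : (k n : ℕ) (A : ArcModel k (suc n)) (S : Subset (suc n)) →
    MaximumIndependent A S →
    Σ (Subset (suc n)) λ T → HittingSet A T × ((∣ T ∣ + 2) * ∣ S ∣ ≤ 3 * suc n)
proposition5p2 k n A S (S-ind , _) =
  let v , small = ∃-below-average (λ v → 𝟙 (v ∈? S)) (λ v → ∣ T[ v ] ∣ + 2) ∑-∣T∣+2
  in  T[ v ] , T-hitting v ,
      subst (λ α → (∣ T[ v ] ∣ + 2) * α ≤ 3 * suc n) (sym (∣p∣≡#∈ S)) small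
  where
  open IntersectionGraph A
  open Trimmed S-ind
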